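{- Let $\mathcal C$ be a social choice rule and let $A$ be a binary relation associated with each profile. If $\mathcal C$ satisfies one of the conditions (wIm$_A$), (Im$_A$), (wP), (sP), (sP'), then both modified rules $\mathcal C^{(C)}$ and $\mathcal C^{(GC)}$ satisfy that same condition.
   Context: Individuals are $N=\{1,\dots,n\}$, $n\ge1$; a profile on a finite set $X$ is a tuple $\mathbb R=(R_1,\dots,R_n)$ of reflexive binary relations on $X$. A social choice rule $\mathcal C$ assigns to every profile $\mathbb R$ on a finite set $X$ and every nonempty $S\subseteq X$ a nonempty set $C(S)=C(S;\mathbb R)\subseteq S$. With $P_i=R_i\setminus R_i^{op}$, $r_{xy}=|\{i:xR_iy\}|$, $p_{xy}=|\{i:xP_iy\}|$, $d_{xy}=|\{i: xR_iy\text{ or }yR_ix\}|$, define $xM_1y\iff p_{xy}\ge n$, $xN_1y\iff r_{xy}\ge n$, $xB_1y\iff p_{xy}\ge d_{xy}>0$ (all made reflexive). For a relation $A$ on $X$, $\mathrm{tr}_S(A)$ is the transitive hull of $A\cap(S\times S)$, i.e. the smallest quasi-order on $S$ containing it. Conditions (for all profiles, all nonempty $S\subseteq X$): (wIm$_A$): if $x\in C(S)$, $y\in S\setminus\{x\}$ and $yAx$, then there is $z\in S\setminus\{y\}$ with $zAy$. (Im$_A$): if $x\in C(S)$, $y\in S$ and $yAx$, then $x\,\mathrm{tr}_S(A)\,y$. (wP) is (Im$_{M_1}$), (sP) is (Im$_{N_1}$), (sP') is (Im$_{B_1}$). Modifications: $C^{(C)}(S):=\{x\}$ if there is $x\in S$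 with $C(\{x,y\})=\{x\}$ for all $y\in S$ (such $x$ is unique), and $C^{(C)}(S):=C(S)$ otherwise; $C^{(GC)}(S):=C(S)\cup\{x\in S: x\in C(\{x,y\})\text{ for all }y\in S\}$. -}

module Defs where

open import Data.Nat using (ℕ; zero; suc; _+_; _≥_; _>_)
open import Data.Bool using (Bool; true; false; if_then_else_)
import Data.Bool as Bool
open import Data.Fin using (Fin; zero; suc)
open import Data.Fin.Subset using (Subset; _∈_; _⊆_; Nonempty; ⁅_⁆; _∪_)
open import Data.Fin.Subset.Properties using (_∈?_)
open import Data.Fin.Properties using (any?; all?)
open import Data.Vec using (tabulate)
open import Data.Vec.Properties using (≡-dec)
open import Data.Product using (Σ; ∃; _×_; _,_)
open import Data.Sum using (_⊎_)
open import Relation.Nullary using (¬_; Dec; yes; no; does)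
open import Relation.Nullary.Decidable using (_×-dec_; _→-dec_)
open import Relation.Binary.PropositionalEquality using (_≡_; _≢_)
open import Relation.Binary.Construct.Closure.ReflexiveTransitive using (Star)

count : ∀ {n} → (Fin n → Bool) → ℕ
count {zero}  f = 0
count {suc n} f = (if f zero then 1 else 0) + count (λ i → f (suc i))

record Profile (n m : ℕ) : Set where
  field
    R    : Fin n → Fin m → Fin m → Bool
    refl : ∀ i x → R i x x ≡ true
open Profile public

_R[_]_ : ∀ {n m} (P : Profile n m) → Fin n → Fin m → Fin m → Bool
_R[_]_ P i x y = R P i x y

strictP : ∀ {n m} → Profile n m → Fin n → Fin m → Fin m → Bool
strictP P i x y = R P i x y Bool.∧ Bool.not (R P i y x)

r p d : ∀ {n m} → Profile n m → Fin m → Fin m → ℕ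
r P x y = count (λ i → R P i x y)
p P x y = count (λ i → strictP P i x y)
d P x y = count (λ i → R P i x y Bool.∨ R P i y x)

-- Relations M1, N1, B1 (made reflexive).
M₁ N₁ B₁ : ∀ {n m} → Profile n m → Fin m → Fin m → Set
M₁ {n} P x y = x ≡ y ⊎ p P x y ≥ n
N₁ {n} P x y = x ≡ y ⊎ r P x y ≥ n
B₁ P x y = x ≡ y ⊎ (p P x y ≥ d P x y × d P x y > 0)

ChoiceFn : ℕ → Set
ChoiceFn n = ∀ {m} → Profile n m → Subset m → Subset m

record SCR (n : ℕ) : Set where
  field
    C        : ChoiceFn n
    C⊆S      : ∀ {m} (P : Profile n m) (S : Subset m) → Nonempty S → C P S ⊆ S
    nonempty : ∀ {m} (P : Profile n m) (S : Subset m) → Nonempty S → Nonempty (C P S)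
open SCR public

AssocRel : ℕ → Set₁
AssocRel n = ∀ {m} → Profile n m → Fin m → Fin m → Set

tr : ∀ {m} → Subset m → (Fin m → Fin m → Set) → Fin m → Fin m → Set
tr S A = Star (λ a b → a ∈ S × b ∈ S × A a b)

wIm : ∀ {n} → AssocRel n → ChoiceFn n → Set
wIm {n} A C = ∀ {m} (P : Profile n m) (S : Subset m) → Nonempty S →
  ∀ x y → x ∈ C P S → y ∈ S → y ≢ x → A P y x →
  ∃ λ z → z ∈ S × z ≢ y × A P z y

Im : ∀ {n} → AssocRel n → ChoiceFn n → Set
Im {n} A C = ∀ {m} (P : Profile n m) (S : Subset m) → Nonempty S →
  ∀ x y → x ∈ C P S → y ∈ S → A P y x → tr S (A P) x y

wP sP sP′ : ∀ {n} → ChoiceFn n → Set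
wP  = Im M₁
sP  = Im N₁
sP′ = Im B₁

pair : ∀ {m} → Fin m → Fin m → Subset m
pair x y = ⁅ x ⁆ ∪ ⁅ y ⁆

condorcet? : ∀ {n m} (C : ChoiceFn n) (P : Profile n m) (S : Subset m) →
  Dec (∃ λ x → x ∈ S × (∀ y → y ∈ S → C P (pair x y) ≡ ⁅ x ⁆))
condorcet? C P S =
  any? (λ x → (x ∈? S) ×-dec all? (λ y → (y ∈? S) →-dec ≡-dec Bool._≟_ (C P (pair x y)) ⁅ x ⁆))

modC : ∀ {n} → ChoiceFn n → ChoiceFn n
modC C P S with condorcet? C P S
... | yes (x , _) = ⁅ x ⁆
... | no _        = C P S

modGC : ∀ {n} → ChoiceFn n → ChoiceFn n
modGC C P S = C P S ∪
  tabulate (λ x → does ((x ∈? S) ×-dec all? (λ y → (y ∈? S) →-dec (x ∈? C P (pair x y)))))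

{-# OPTIONS --safe #-}
-- Both modified rules choose only elements of C(S) and elements x ∈ S with
-- x ∈ C({x,y}) for every y ∈ S; the Condorcet winner of C^(C) is of the second
-- kind, so C^(C)(S) ⊆ C^(GC)(S).  All five conditions only weaken when the chosen
-- sets shrink, so it suffices to treat C^(GC).  For an element x of the second kind
-- and y ∈ S, applying the condition of C to the pair {x,y} yields a witness, resp.
-- an A-chain, inside {x,y} ⊆ S, which serves for S as well.  Nothing about 𝒞
-- beyond its choice function is used, and neither is n ≥ 1.
module Submission where

open import Defs
open import Data.Nat using (ℕ; _≥_)
open import Data.Bool using (true)
open import Data.Product using (_×_; _,_)
open import Data.Sum using (_⊎_; inj₁; inj₂)
open import Data.Fin using (Fin)
open import Data.Fin.Subset using (Subset; _∈_; _⊆_; _∪_)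
open import Data.Fin.Subset.Properties
  using (_∈?_; x∈⁅x⁆; x∈⁅y⁆⇒x≡y; x∈p∪q⁻; x∈p∪q⁺; p⊆p∪q; q⊆p∪q)
open import Data.Fin.Properties using (all?)
open import Data.Vec using (tabulate)
open import Data.Vec.Properties using ([]=⇒lookup; lookup⇒[]=; lookup∘tabulate)
open import Relation.Nullary using (Dec; yes; no; does)
open import Relation.Nullary.Decidable using (_×-dec_; _→-dec_; dec-true)
open import Relation.Binary.PropositionalEquality using (_≡_; refl; sym; trans; subst)
open import Relation.Binary.Construct.Closure.ReflexiveTransitive using (map)

module _ {m : ℕ} where

  ∈-tabulate⁻ : ∀ {f} {x : Fin m} → x ∈ tabulate f → f x ≡ true
  ∈-tabulate⁻ {f} {x} x∈ = trans (sym (lookup∘tabulate f x)) ([]=⇒lookup x∈)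

  ∈-tabulate⁺ : ∀ {f} {x : Fin m} → f x ≡ true → x ∈ tabulate f
  ∈-tabulate⁺ {f} {x} fx = lookup⇒[]= x (tabulate f) (trans (lookup∘tabulate f x) fx)

  ∈-tabulate-does⁻ : ∀ {Q : Fin m → Set} (Q? : ∀ x → Dec (Q x)) {x} →
                     x ∈ tabulate (λ x → does (Q? x)) → Q x
  ∈-tabulate-does⁻ Q? {x} x∈ with Q? x | ∈-tabulate⁻ x∈
  ... | yes q | _  = q
  ... | no _  | ()

  ∈-tabulate-does⁺ : ∀ {Q : Fin m → Set} (Q? : ∀ x → Dec (Q x)) {x} →
                     Q x → x ∈ tabulate (λ x → does (Q? x))
  ∈-tabulate-does⁺ Q? {x} q = ∈-tabulate⁺ (dec-true (Q? x) q)

  x∈pair : (x y : Fin m) → x ∈ pair x y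
  x∈pair x y = x∈p∪q⁺ (inj₁ (x∈⁅x⁆ x))

  y∈pair : (x y : Fin m) → y ∈ pair x y
  y∈pair x y = x∈p∪q⁺ (inj₂ (x∈⁅x⁆ y))

  pair⊆ : ∀ {S : Subset m} {x y} → x ∈ S → y ∈ S → pair x y ⊆ S
  pair⊆ {x = x} {y} x∈S y∈S z∈ with x∈p∪q⁻ _ _ z∈
  ... | inj₁ z∈⁅x⁆ = subst (_∈ _) (sym (x∈⁅y⁆⇒x≡y x z∈⁅x⁆)) x∈S
  ... | inj₂ z∈⁅y⁆ = subst (_∈ _) (sym (x∈⁅y⁆⇒x≡y y z∈⁅y⁆)) y∈S

  tr-mono : ∀ {S T : Subset m} {A} → S ⊆ T → ∀ {x y} → tr S A x y → tr T A x y
  tr-mono S⊆T = map (λ (a∈S , b∈S , a~b) → S⊆T a∈S , S⊆T b∈S , a~b)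

module _ {n : ℕ} where

  PairwiseChosen : ∀ {m} → ChoiceFn n → Profile n m → Subset m → Fin m → Set
  PairwiseChosen C P S x = x ∈ S × (∀ y → y ∈ S → x ∈ C P (pair x y))

  _⊆ᶜ_ : ChoiceFn n → ChoiceFn n → Set
  F ⊆ᶜ G = ∀ {m} (P : Profile n m) (S : Subset m) → F P S ⊆ G P S

  module _ (C : ChoiceFn n) {m} (P : Profile n m) (S : Subset m) where

    pairwiseChosen? : ∀ x → Dec (PairwiseChosen C P S x)
    pairwiseChosen? x =
      (x ∈? S) ×-dec all? (λ y → (y ∈? S) →-dec (x ∈? C P (pair x y)))

    ∈-modGC⁻ : ∀ {x} → x ∈ modGC C P S → x ∈ C P S ⊎ PairwiseChosen C P S x
    ∈-modGC⁻ x∈ with x∈p∪q⁻ (C P S) _ x∈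
    ... | inj₁ x∈C = inj₁ x∈C
    ... | inj₂ x∈W = inj₂ (∈-tabulate-does⁻ pairwiseChosen? x∈W)

    pairwiseChosen⇒∈-modGC : ∀ {x} → PairwiseChosen C P S x → x ∈ modGC C P S
    pairwiseChosen⇒∈-modGC pc =
      q⊆p∪q (C P S) _ (∈-tabulate-does⁺ pairwiseChosen? pc)

  modC⊆modGC : (C : ChoiceFn n) → modC C ⊆ᶜ modGC C
  modC⊆modGC C P S x∈ with condorcet? C P S
  ... | no _ = p⊆p∪q _ x∈
  ... | yes (w , w∈S , wins) with x∈⁅y⁆⇒x≡y w x∈
  ... | refl = pairwiseChosen⇒∈-modGC C P S
                 (w∈S , λ y y∈S → subst (w ∈_) (sym (wins y y∈S)) (x∈⁅x⁆ w))

  wIm-antitone : ∀ (A : AssocRel n) {F G : ChoiceFn n} → F ⊆ᶜ G → wIm A G → wIm A F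
  wIm-antitone A F⊆G wImG P S ne x y x∈F = wImG P S ne x y (F⊆G P S x∈F)

  Im-antitone : ∀ (A : AssocRel n) {F G : ChoiceFn n} → F ⊆ᶜ G → Im A G → Im A F
  Im-antitone A F⊆G ImG P S ne x y x∈F = ImG P S ne x y (F⊆G P S x∈F)

  wIm-modGC : ∀ (A : AssocRel n) (C : ChoiceFn n) → wIm A C → wIm A (modGC C)
  wIm-modGC A C wImC P S ne x y x∈ y∈S y≢x yAx with ∈-modGC⁻ C P S x∈
  ... | inj₁ x∈C = wImC P S ne x y x∈C y∈S y≢x yAx
  ... | inj₂ (x∈S , x∈C[xy])
      with wImC P (pair x y) (x , x∈pair x y) x y (x∈C[xy] y y∈S) (y∈pair x y) y≢x yAx
  ... | z , z∈xy , z≢y , zAy = z , pair⊆ x∈S y∈S z∈xy , z≢y , zAy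

  Im-modGC : ∀ (A : AssocRel n) (C : ChoiceFn n) → Im A C → Im A (modGC C)
  Im-modGC A C ImC P S ne x y x∈ y∈S yAx with ∈-modGC⁻ C P S x∈
  ... | inj₁ x∈C = ImC P S ne x y x∈C y∈S yAx
  ... | inj₂ (x∈S , x∈C[xy]) =
    tr-mono (pair⊆ x∈S y∈S)
      (ImC P (pair x y) (x , x∈pair x y) x y (x∈C[xy] y y∈S) (y∈pair x y) yAx)

  preserved-by-modC-modGC : (Cond : ChoiceFn n → Set) →
    (∀ {F G : ChoiceFn n} → F ⊆ᶜ G → Cond G → Cond F) →
    (∀ (C : ChoiceFn n) → Cond C → Cond (modGC C)) →
    ∀ (C : ChoiceFn n) → Cond C → Cond (modC C) × Cond (modGC C)
  preserved-by-modC-modGC Cond antitone preserved-modGC C condC =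
    antitone (modC⊆modGC C) (preserved-modGC C condC) , preserved-modGC C condC

  Im-preserved : ∀ (A : AssocRel n) (C : ChoiceFn n) →
                 Im A C → Im A (modC C) × Im A (modGC C)
  Im-preserved A = preserved-by-modC-modGC (Im A) (Im-antitone A) (Im-modGC A)

  wIm-preserved : ∀ (A : AssocRel n) (C : ChoiceFn n) →
                  wIm A C → wIm A (modC C) × wIm A (modGC C)
  wIm-preserved A = preserved-by-modC-modGC (wIm A) (wIm-antitone A) (wIm-modGC A)

lemma4 : ∀ (n : ℕ) → n ≥ 1 → (𝒞 : SCR n) →
    ((A : AssocRel n) → wIm A (C 𝒞) → wIm A (modC (C 𝒞)) × wIm A (modGC (C 𝒞)))
    × ((A : AssocRel n) → Im A (C 𝒞) → Im A (modC (C 𝒞)) × Im A (modGC (C 𝒞)))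
    × (wP (C 𝒞) → wP (modC (C 𝒞)) × wP (modGC (C 𝒞)))
    × (sP (C 𝒞) → sP (modC (C 𝒞)) × sP (modGC (C 𝒞)))
    × (sP′ (C 𝒞) → sP′ (modC (C 𝒞)) × sP′ (modGC (C 𝒞)))
lemma4 n _ 𝒞 =
    (λ A → wIm-preserved A (C 𝒞))
  , (λ A → Im-preserved A (C 𝒞))
  , Im-preserved M₁ (C 𝒞)
  , Im-preserved N₁ (C 𝒞)
  , Im-preserved B₁ (C 𝒞)
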